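{- Let $n\ge1$ and let $\pi\in S_n$ avoid the classical pattern $312$. Then the number of occurrences of the vincular pattern $\underline{23}1$ in $\pi$ is $$\underline{23}1(\pi)=\sum_{i\in\mathrm{Lmax}(\pi)}(\pi_i-i)-n+\mathrm{lmax}(\pi).$$
   Context: $S_n$ is the set of permutations of $[n]$ in one-line notation. $\pi$ avoids $312$ if there are no indices $a<b<c$ with $\pi_b<\pi_c<\pi_a$. $\underline{23}1(\pi)=\#\{(i,j): i+1<j\le n,\ \pi_j<\pi_i<\pi_{i+1}\}$. $\mathrm{Lmax}(\pi)$ is the set of positions $i$ with $\pi_i>\pi_j$ for all $j<i$, and $\mathrm{lmax}(\pi)=|\mathrm{Lmax}(\pi)|$. -}

module Defs where

open import Data.Nat using (ℕ; zero; suc; _<_; _<?_)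
open import Data.Fin using (Fin; toℕ; fromℕ<)
open import Data.Integer using (ℤ; +_; _-_; _+_)
open import Data.List using (List; []; _∷_;  length; filter; map; allFin; cartesianProduct)
open import Data.Product using (_×_; _,_; proj₁; proj₂)
open import Data.Bool using (Bool; not; _∨_; true; false; _∧_; T?)
open import Relation.Nullary using (¬_; yes; no)
open import Relation.Nullary.Decidable using (⌊_⌋)
open import Function.Definitions using (Injective)
open import Relation.Binary.PropositionalEquality using (_≡_)

-- Positions and values are 0-based in Fin n;
-- the paper's 1-based π_i and i are toℕ (π i) + 1 and toℕ i + 1.
IsPerm : (n : ℕ) → (Fin n → Fin n) → Set
IsPerm n π = Injective _≡_ _≡_ π

Avoids312 : (n : ℕ) → (Fin n → Fin n) → Set
Avoids312 n π = (a b c : Fin n) → toℕ a < toℕ b → toℕ b < toℕ c →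
  ¬ ((toℕ (π b) < toℕ (π c)) × (toℕ (π c) < toℕ (π a)))

_<ᵇ_ : ℕ → ℕ → Bool
m <ᵇ k = ⌊ m <? k ⌋

valAt : (n : ℕ) → (Fin n → Fin n) → ℕ → ℕ
valAt n π k with k <? n
... | yes k<n = toℕ (π (fromℕ< k<n))
... | no _ = 0

-- 23-1 occurrence at 0-based positions (i, j): i+1 < j, π_j < π_i < π_{i+1}
-- (the condition i+1 < j with j < n guarantees position i+1 exists)
occ-23-1 : (n : ℕ) → (Fin n → Fin n) → Fin n → Fin n → Bool
occ-23-1 n π i j = (suc (toℕ i) <ᵇ toℕ j) ∧ (toℕ (π j) <ᵇ toℕ (π i))
                     ∧ (toℕ (π i) <ᵇ valAt n π (suc (toℕ i)))

count-23-1 : (n : ℕ) → (Fin n → Fin n) → ℕ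
count-23-1 n π =
  length (filter (λ p → T? (occ-23-1 n π (proj₁ p) (proj₂ p)))
                 (cartesianProduct (allFin n) (allFin n)))

isLmax : (n : ℕ) → (Fin n → Fin n) → Fin n → Bool
isLmax n π i = allB (allFin n)
  where
    allB : List (Fin n) → Bool
    allB [] = true
    allB (j ∷ js) = (not ⌊ toℕ j <? toℕ i ⌋ ∨ (toℕ (π j) <ᵇ toℕ (π i))) ∧ allB js

Lmax : (n : ℕ) → (Fin n → Fin n) → List (Fin n)
Lmax n π = filter (λ i → T? (isLmax n π i)) (allFin n)

lmax : (n : ℕ) → (Fin n → Fin n) → ℕ
lmax n π = length (Lmax n π)

-- Σ_{i ∈ Lmax(π)} (π_i − i), in ℤ (1-based shift cancels)
sumLmax : (n : ℕ) → (Fin n → Fin n) → ℤ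
sumLmax n π = Data.List.foldr _+_ (+ 0)
  (map (λ i → (+ toℕ (π i)) - (+ toℕ i)) (Lmax n π))

{-# OPTIONS --safe #-}
-- Let ls(i) be the number of j > i with π_j < π_i. In a 312-avoider an ascent
-- π_m < π_{m+1} forces m+1 to be a left-to-right maximum, and at a descent
-- ls(m) = ls(m+1) + 1. So the number of 23-1 occurrences with first letter at m,
-- which is ls(m) at an ascent and 0 at a descent, equals ls(m) − c(m+1), where
-- c(i) = 0 for i ∈ Lmax or i = n, and c(i) = ls(i) + 1 otherwise. Summing over m
-- the carries c telescope, leaving Σ_{i ∈ Lmax} ls(i) − (n − lmax(π)); finally
-- ls(i) = π_i − i at a left-to-right maximum, as every smaller value occurs after it.

module Submission where

open import Defs
open import Data.Bool using (Bool; true; false; not; _∧_; _∨_; T?)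
open import Data.Empty using (⊥; ⊥-elim)
open import Data.Fin as Fin using (Fin; toℕ; fromℕ<)
open import Data.Fin.Properties using (toℕ<n; toℕ-fromℕ<; fromℕ<-toℕ; toℕ-injective)
open import Data.Integer as ℤ using (ℤ; +_)
open import Data.Integer.Properties using (pos-+)
open import Data.Integer.Solver using (module +-*-Solver)
open import Data.List using (List; []; _∷_; _++_; length; filter; map; foldr; tabulate; allFin; cartesianProduct)
open import Data.List.Properties using (map-++; map-∘; map-tabulate)
open import Data.List.Relation.Unary.All as All using (All)
open import Data.List.Relation.Unary.All.Properties using (tabulate⁺; tabulate⁻)
open import Data.Nat using (ℕ; zero; suc; _+_; _∸_; _≤_; _<_; _≮_; _≥_; z≤n; _≟_; _<?_)
open import Data.Nat.ListAction using (sum)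
open import Data.Nat.ListAction.Properties using (sum-++)
open import Data.Nat.Properties
open import Data.Product using (_×_; _,_; proj₁; proj₂)
open import Data.Sum using (_⊎_; inj₁; inj₂; [_,_])
open import Function using (_∘_; _⇔_; mk⇔; Equivalence)
open import Relation.Binary.PropositionalEquality using (_≡_; _≢_; refl; sym; trans; cong; cong₂; subst; subst₂; module ≡-Reasoning)
open import Relation.Binary.Definitions using (tri<; tri≈; tri>)
open import Relation.Nullary using (¬_; Dec; yes; no; contradiction)
open import Relation.Nullary.Decidable using (⌊_⌋; does; isYes≗does; dec-true; dec-false; does-≡; map′; _×-dec_; _→-dec_; ¬?)
open import Relation.Unary using (Decidable)

open import Algebra.Properties.CommutativeSemigroup +-commutativeSemigroup
  using () renaming (interchange to +-interchange; xy∙z≈xz∙y to +-right-comm)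
open Equivalence using (to; from)

-- Finite sums and counting over [0, m)

sumBelow : ℕ → (ℕ → ℕ) → ℕ
sumBelow zero    f = 0
sumBelow (suc m) f = sumBelow m f + f m

syntax sumBelow m (λ j → e) = ∑[ j < m ] e

sumBelow-cong : ∀ m {f g : ℕ → ℕ} → (∀ {j} → j < m → f j ≡ g j) → sumBelow m f ≡ sumBelow m g
sumBelow-cong zero    f≗g = refl
sumBelow-cong (suc m) f≗g = cong₂ _+_ (sumBelow-cong m (f≗g ∘ m<n⇒m<1+n)) (f≗g (n<1+n m))

sumBelow-+ : ∀ m (f g : ℕ → ℕ) → (∑[ j < m ] (f j + g j)) ≡ sumBelow m f + sumBelow m g
sumBelow-+ zero    f g = refl
sumBelow-+ (suc m) f g =
  trans (cong (_+ (f m + g m)) (sumBelow-+ m f g)) (+-interchange (sumBelow m f) (sumBelow m g) (f m) (g m))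

sumBelow-suc : ∀ m (f : ℕ → ℕ) → sumBelow (suc m) f ≡ f 0 + sumBelow m (f ∘ suc)
sumBelow-suc zero    f = +-comm 0 (f 0)
sumBelow-suc (suc m) f = trans (cong (_+ f (suc m)) (sumBelow-suc m f)) (+-assoc (f 0) _ _)

sumBelow-rotate : ∀ m (f : ℕ → ℕ) → f 0 ≡ f m → sumBelow m (f ∘ suc) ≡ sumBelow m f
sumBelow-rotate m f f0≡fm = +-cancelˡ-≡ (f 0) _ _ (begin
  f 0 + sumBelow m (f ∘ suc) ≡⟨ sumBelow-suc m f ⟨
  sumBelow m f + f m         ≡⟨ cong (λ x → sumBelow m f + x) f0≡fm ⟨
  sumBelow m f + f 0         ≡⟨ +-comm (sumBelow m f) (f 0) ⟩
  f 0 + sumBelow m f         ∎)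
  where open ≡-Reasoning

indicator : Bool → ℕ
indicator true  = 1
indicator false = 0

count : ∀ {Q : ℕ → Set} → ℕ → Decidable Q → ℕ
count m Q? = ∑[ j < m ] indicator (does (Q? j))

count-cong : ∀ m {Q R : ℕ → Set} (Q? : Decidable Q) (R? : Decidable R) →
             (∀ {j} → j < m → Q j ⇔ R j) → count m Q? ≡ count m R?
count-cong m Q? R? Q⇔R = sumBelow-cong m λ {j} j<m →
  cong indicator (does-≡ (Q? j) (map′ (from (Q⇔R j<m)) (to (Q⇔R j<m)) (R? j)))

count-⊎ : ∀ m {Q R S : ℕ → Set} (Q? : Decidable Q) (R? : Decidable R) (S? : Decidable S) →
          (∀ {j} → j < m → Q j ⇔ (R j ⊎ S j)) → (∀ {j} → R j → S j → ⊥) →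
          count m Q? ≡ count m R? + count m S?
count-⊎ m Q? R? S? Q⇔R⊎S disjoint = trans (sumBelow-cong m split) (sumBelow-+ m _ _)
  where
  split : ∀ {j} → j < m → indicator (does (Q? j)) ≡ indicator (does (R? j)) + indicator (does (S? j))
  split {j} j<m with R? j | S? j
  ... | yes r | yes s = ⊥-elim (disjoint r s)
  ... | yes r | no _  = cong indicator (dec-true (Q? j) (from (Q⇔R⊎S j<m) (inj₁ r)))
  ... | no _  | yes s = cong indicator (dec-true (Q? j) (from (Q⇔R⊎S j<m) (inj₂ s)))
  ... | no ¬r | no ¬s = cong indicator (dec-false (Q? j) ([ ¬r , ¬s ] ∘ to (Q⇔R⊎S j<m)))

count-none : ∀ m {Q : ℕ → Set} (Q? : Decidable Q) → (∀ {j} → j < m → ¬ Q j) → count m Q? ≡ 0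
count-none zero    Q? ¬Q = refl
count-none (suc m) Q? ¬Q =
  cong₂ _+_ (count-none m Q? (¬Q ∘ m<n⇒m<1+n)) (cong indicator (dec-false (Q? m) (¬Q (n<1+n m))))

count-all : ∀ m {Q : ℕ → Set} (Q? : Decidable Q) → (∀ {j} → j < m → Q j) → count m Q? ≡ m
count-all zero    Q? allQ = refl
count-all (suc m) Q? allQ =
  trans (cong₂ _+_ (count-all m Q? (allQ ∘ m<n⇒m<1+n)) (cong indicator (dec-true (Q? m) (allQ (n<1+n m)))))
        (+-comm m 1)

count-complement : ∀ m {Q : ℕ → Set} (Q? : Decidable Q) → count m (¬? ∘ Q?) + count m Q? ≡ m
count-complement zero    Q? = refl
count-complement (suc m) Q? = begin
  (count m (¬? ∘ Q?) + indicator (not (does (Q? m)))) + (count m Q? + indicator (does (Q? m)))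
    ≡⟨ +-interchange (count m (¬? ∘ Q?)) _ (count m Q?) _ ⟩
  (count m (¬? ∘ Q?) + count m Q?) + (indicator (not (does (Q? m))) + indicator (does (Q? m)))
    ≡⟨ cong₂ _+_ (count-complement m Q?) (indicator-not+indicator (does (Q? m))) ⟩
  m + 1
    ≡⟨ +-comm m 1 ⟩
  suc m ∎
  where
  open ≡-Reasoning
  indicator-not+indicator : ∀ b → indicator (not b) + indicator b ≡ 1
  indicator-not+indicator true  = refl
  indicator-not+indicator false = refl

count-≡ : ∀ m {k} → k < m → count m (_≟ k) ≡ 1
count-≡ (suc m) {k} k<1+m with m<1+n⇒m<n∨m≡n k<1+m
... | inj₁ k<m  = cong₂ _+_ (count-≡ m k<m) (cong indicator (dec-false (m ≟ k) (>⇒≢ k<m)))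
... | inj₂ refl = cong₂ _+_ (count-none k (_≟ k) <⇒≢) (cong indicator (dec-true (k ≟ k) refl))

count-< : ∀ m {i} → i ≤ m → count m (_<? i) ≡ i
count-< zero    z≤n = refl
count-< (suc m) {i} i≤1+m with m≤n⇒m<n∨m≡n i≤1+m
... | inj₁ i<1+m = trans (cong₂ _+_ (count-< m (m<1+n⇒m≤n i<1+m))
                                    (cong indicator (dec-false (m <? i) (≤⇒≯ (m<1+n⇒m≤n i<1+m)))))
                         (+-identityʳ i)
... | inj₂ refl  = trans (cong₂ _+_ (count-all m (_<? suc m) m<n⇒m<1+n)
                                    (cong indicator (dec-true (m <? suc m) (n<1+n m))))
                         (+-comm m 1)

count-<-suc : ∀ m (f : ℕ → ℕ) v →
              count m (λ j → f j <? suc v) ≡ count m (λ j → f j <? v) + count m (λ j → f j ≟ v)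
count-<-suc m f v = count-⊎ m (λ j → f j <? suc v) (λ j → f j <? v) (λ j → f j ≟ v)
  (λ _ → mk⇔ m<1+n⇒m<n∨m≡n [ m<n⇒m<1+n , (λ { refl → n<1+n v }) ])
  (λ fj<v fj≡v → <⇒≢ fj<v fj≡v)

module _ (m : ℕ) {f : ℕ → ℕ} (f-injective : ∀ {j k} → j < m → k < m → f j ≡ f k → j ≡ k) where

  count-fibre-≤1 : ∀ v → count m (λ j → f j ≟ v) ≤ 1
  count-fibre-≤1 v with anyUpTo? (λ j → f j ≟ v) m
  ... | yes (k , k<m , fk≡v) = ≤-reflexive (trans (count-cong m (λ j → f j ≟ v) (_≟ k) fibre⇔) (count-≡ m k<m))
    where
    fibre⇔ : ∀ {j} → j < m → (f j ≡ v) ⇔ (j ≡ k)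
    fibre⇔ j<m = mk⇔ (λ fj≡v → f-injective j<m k<m (trans fj≡v (sym fk≡v))) (λ { refl → fk≡v })
  ... | no ∄ = ≤-trans (≤-reflexive (count-none m (λ j → f j ≟ v) λ j<m fj≡v → ∄ (_ , j<m , fj≡v))) z≤n

  count-<-+ : ∀ k v → count m (λ j → f j <? k + v) ≤ count m (λ j → f j <? v) + k
  count-<-+ zero    v = ≤-reflexive (sym (+-identityʳ _))
  count-<-+ (suc k) v = begin
    count m (λ j → f j <? suc (k + v))                          ≡⟨ count-<-suc m f (k + v) ⟩
    count m (λ j → f j <? k + v) + count m (λ j → f j ≟ k + v) ≤⟨ +-mono-≤ (count-<-+ k v) (count-fibre-≤1 (k + v)) ⟩
    count m (λ j → f j <? v) + k + 1                            ≡⟨ +-assoc _ k 1 ⟩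
    count m (λ j → f j <? v) + (k + 1)                          ≡⟨ cong (λ x → count m (λ j → f j <? v) + x) (+-comm k 1) ⟩
    count m (λ j → f j <? v) + suc k                            ∎
    where open ≤-Reasoning

  count-<-injective : (∀ {j} → j < m → f j < m) → ∀ {v} → v ≤ m → count m (λ j → f j <? v) ≡ v
  count-<-injective f-bounded {v} v≤m = ≤-antisym at-most at-least
    where
    at-most : count m (λ j → f j <? v) ≤ v
    at-most = begin
      count m (λ j → f j <? v)        ≡⟨ cong (λ w → count m (λ j → f j <? w)) (+-identityʳ v) ⟨
      count m (λ j → f j <? v + 0)    ≤⟨ count-<-+ v 0 ⟩
      count m (λ j → f j <? 0) + v    ≡⟨ cong (_+ v) (count-none m (λ j → f j <? 0) λ _ → n≮0) ⟩
      v                               ∎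
      where open ≤-Reasoning
    at-least : v ≤ count m (λ j → f j <? v)
    at-least = +-cancelʳ-≤ (m ∸ v) v _ (begin
      v + (m ∸ v)                                ≡⟨ m+[n∸m]≡n v≤m ⟩
      m                                          ≡⟨ count-all m (λ j → f j <? m) f-bounded ⟨
      count m (λ j → f j <? m)                   ≡⟨ cong (λ w → count m (λ j → f j <? w)) (m∸n+n≡m v≤m) ⟨
      count m (λ j → f j <? (m ∸ v) + v)         ≤⟨ count-<-+ (m ∸ v) v ⟩
      count m (λ j → f j <? v) + (m ∸ v)         ∎)
      where open ≤-Reasoning

-- Sums over lists

length-filter-T? : ∀ {A : Set} (b : A → Bool) xs → length (filter (T? ∘ b) xs) ≡ sum (map (indicator ∘ b) xs)
length-filter-T? b [] = refl
length-filter-T? b (x ∷ xs) with b x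
... | true  = cong suc (length-filter-T? b xs)
... | false = length-filter-T? b xs

sum-map-cartesianProduct : ∀ {A B : Set} (h : A × B → ℕ) xs ys →
  sum (map h (cartesianProduct xs ys)) ≡ sum (map (λ x → sum (map (λ y → h (x , y)) ys)) xs)
sum-map-cartesianProduct h []       ys = refl
sum-map-cartesianProduct h (x ∷ xs) ys = begin
  sum (map h (map (x ,_) ys ++ cartesianProduct xs ys))               ≡⟨ cong sum (map-++ h (map (x ,_) ys) _) ⟩
  sum (map h (map (x ,_) ys) ++ map h (cartesianProduct xs ys))       ≡⟨ sum-++ (map h (map (x ,_) ys)) _ ⟩
  sum (map h (map (x ,_) ys)) + sum (map h (cartesianProduct xs ys))  ≡⟨ cong₂ _+_ (cong sum (sym (map-∘ ys))) (sum-map-cartesianProduct h xs ys) ⟩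
  sum (map (λ y → h (x , y)) ys) + sum (map (λ x → sum (map (λ y → h (x , y)) ys)) xs) ∎
  where open ≡-Reasoning

sum-tabulate : ∀ m (f : Fin m → ℕ) (g : ℕ → ℕ) → (∀ i → f i ≡ g (toℕ i)) → sum (tabulate f) ≡ sumBelow m g
sum-tabulate zero    f g f≡g = refl
sum-tabulate (suc m) f g f≡g =
  trans (cong₂ _+_ (f≡g Fin.zero) (sum-tabulate m (f ∘ Fin.suc) (g ∘ suc) (f≡g ∘ Fin.suc))) (sym (sumBelow-suc m g))

sum-map-allFin : ∀ m (f : Fin m → ℕ) (g : ℕ → ℕ) → (∀ i → f i ≡ g (toℕ i)) → sum (map f (allFin m)) ≡ sumBelow m g
sum-map-allFin m f g f≡g = trans (cong sum (map-tabulate (λ i → i) f)) (sum-tabulate m f g f≡g)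

foldr-+-map-filter : ∀ {A : Set} (b : A → Bool) (g : A → ℤ) (h : A → ℕ) →
  (∀ x → b x ≡ true → g x ≡ + h x) → (∀ x → b x ≡ false → h x ≡ 0) →
  ∀ xs → foldr ℤ._+_ (+ 0) (map g (filter (T? ∘ b) xs)) ≡ + sum (map h xs)
foldr-+-map-filter b g h g≡h h≡0 [] = refl
foldr-+-map-filter b g h g≡h h≡0 (x ∷ xs) with b x in bx
... | true  = trans (cong₂ ℤ._+_ (g≡h x bx) (foldr-+-map-filter b g h g≡h h≡0 xs)) (sym (pos-+ (h x) _))
... | false = trans (foldr-+-map-filter b g h g≡h h≡0 xs) (cong (λ k → + (k + sum (map h xs))) (sym (h≡0 x bx)))

all-unique : ∀ {A : Set} {Q : A → Set} (Q? : Decidable Q) (c : A → Bool) (F : List A → Bool) →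
  (∀ x → c x ≡ does (Q? x)) → F [] ≡ true → (∀ x xs → F (x ∷ xs) ≡ c x ∧ F xs) →
  ∀ xs → F xs ≡ does (All.all? Q? xs)
all-unique Q? c F c≡Q? F[] F∷ []       = F[]
all-unique Q? c F c≡Q? F[] F∷ (x ∷ xs) = trans (F∷ x xs) (cong₂ _∧_ (c≡Q? x) (all-unique Q? c F c≡Q? F[] F∷ xs))

+[m+n]-+n≡+m : ∀ m n → + (m + n) ℤ.- + n ≡ + m
+[m+n]-+n≡+m m n = trans (cong (ℤ._- + n) (pos-+ m n)) (solve 2 (λ m n → (m :+ n) :- n := m) refl (+ m) (+ n))
  where open +-*-Solver

+m≡+[m+n]-+[n+o]++o : ∀ m n o → + m ≡ (+ (m + n) ℤ.- + (n + o)) ℤ.+ + o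
+m≡+[m+n]-+[n+o]++o m n o = begin
  + m                                              ≡⟨ solve 3 (λ m n o → m := ((m :+ n) :- (n :+ o)) :+ o) refl (+ m) (+ n) (+ o) ⟩
  ((+ m ℤ.+ + n) ℤ.- (+ n ℤ.+ + o)) ℤ.+ + o        ≡⟨ cong₂ (λ x y → (x ℤ.- y) ℤ.+ + o) (pos-+ m n) (pos-+ n o) ⟨
  (+ (m + n) ℤ.- + (n + o)) ℤ.+ + o                ∎
  where
  open ≡-Reasoning
  open +-*-Solver

-- 23-1 occurrences in a sequence of naturals

module Vincular231 (n : ℕ) (P : ℕ → ℕ) where

  IsLeftMax : ℕ → Set
  IsLeftMax i = ∀ {j} → j < i → P j < P i

  isLeftMax? : Decidable IsLeftMax
  isLeftMax? i = allUpTo? (λ j → P j <? P i) i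

  Occurrence : ℕ → ℕ → Set
  Occurrence i j = suc i < j × P j < P i × P i < P (suc i)

  occurrence? : ∀ i → Decidable (Occurrence i)
  occurrence? i j = (suc i <? j) ×-dec (P j <? P i) ×-dec (P i <? P (suc i))

  occurrencesAt : ℕ → ℕ
  occurrencesAt i = count n (occurrence? i)

  LaterSmaller : ℕ → ℕ → Set
  LaterSmaller i j = i < j × P j < P i

  laterSmaller? : ∀ i → Decidable (LaterSmaller i)
  laterSmaller? i j = (i <? j) ×-dec (P j <? P i)

  laterSmaller : ℕ → ℕ
  laterSmaller i = count n (laterSmaller? i)

  lmaxWeight : ℕ → ℕ
  lmaxWeight i with isLeftMax? i
  ... | yes _ = laterSmaller i
  ... | no _  = 0

  carry : ℕ → ℕ
  carry i with i <? n | isLeftMax? i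
  ... | yes _ | no _ = suc (laterSmaller i)
  ... | _     | _    = 0

  lmaxWeight+carry : ∀ {m} → m < n → lmaxWeight m + carry m ≡ laterSmaller m + indicator (does (¬? (isLeftMax? m)))
  lmaxWeight+carry {m} m<n with m <? n | isLeftMax? m
  ... | no m≮n | _     = contradiction m<n m≮n
  ... | yes _  | yes _ = refl
  ... | yes _  | no _  = +-comm 1 (laterSmaller m)

  occurrencesAt-ascent : ∀ {m} → P m < P (suc m) → occurrencesAt m ≡ laterSmaller m
  occurrencesAt-ascent {m} ascent =
    count-cong n (occurrence? m) (laterSmaller? m) λ _ → mk⇔
      (λ (1+m<j , Pj<Pm , _) → <-trans (n<1+n m) 1+m<j , Pj<Pm)
      (λ (m<j , Pj<Pm) → ≤∧≢⇒< m<j (λ { refl → <-asym ascent Pj<Pm }) , Pj<Pm , ascent)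

  occurrencesAt-descent : ∀ {m} → P m ≮ P (suc m) → occurrencesAt m ≡ 0
  occurrencesAt-descent {m} ¬ascent = count-none n (occurrence? m) λ _ → ¬ascent ∘ proj₂ ∘ proj₂

  occurrencesAt-last : ∀ {m} → suc m ≮ n → occurrencesAt m ≡ 0
  occurrencesAt-last {m} 1+m≮n = count-none n (occurrence? m) λ j<n → 1+m≮n ∘ (λ 1+m<j → <-trans 1+m<j j<n) ∘ proj₁

  laterSmaller-last : ∀ {m} → suc m ≮ n → laterSmaller m ≡ 0
  laterSmaller-last {m} 1+m≮n = count-none n (laterSmaller? m) λ j<n → 1+m≮n ∘ (λ m<j → ≤-<-trans m<j j<n) ∘ proj₁

  carry-0 : carry 0 ≡ 0
  carry-0 with 0 <? n
  ... | yes _ = refl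
  ... | no _  = refl

  carry-n : carry n ≡ 0
  carry-n with n <? n
  ... | yes n<n = contradiction n<n (<-irrefl refl)
  ... | no _    = refl

  module _ (P-injective : ∀ {j k} → j < n → k < n → P j ≡ P k → j ≡ k) where

    P-≮⇒> : ∀ {j k} → j < n → k < n → j ≢ k → P j ≮ P k → P k < P j
    P-≮⇒> j<n k<n j≢k Pj≮Pk = ≤∧≢⇒< (≮⇒≥ Pj≮Pk) (j≢k ∘ P-injective j<n k<n ∘ sym)

    laterSmaller-isLeftMax : (∀ {j} → j < n → P j < n) → ∀ {i} → i < n → IsLeftMax i → laterSmaller i + i ≡ P i
    laterSmaller-isLeftMax P-bounded {i} i<n lmax = begin
      laterSmaller i + i                     ≡⟨ +-comm (laterSmaller i) i ⟩
      i + laterSmaller i                     ≡⟨ cong (_+ laterSmaller i) (count-< n (<⇒≤ i<n)) ⟨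
      count n (_<? i) + laterSmaller i       ≡⟨ count-⊎ n (λ j → P j <? P i) (_<? i) (laterSmaller? i) below⇔ disjoint ⟨
      count n (λ j → P j <? P i)             ≡⟨ count-<-injective n P-injective P-bounded (<⇒≤ (P-bounded i<n)) ⟩
      P i                                    ∎
      where
      open ≡-Reasoning
      below⇔ : ∀ {j} → j < n → P j < P i ⇔ (j < i ⊎ LaterSmaller i j)
      below⇔ {j} j<n = mk⇔ split [ lmax , proj₂ ]
        where
        split : P j < P i → j < i ⊎ LaterSmaller i j
        split Pj<Pi with <-cmp j i
        ... | tri< j<i _ _ = inj₁ j<i
        ... | tri≈ _ refl _ = contradiction Pj<Pi (<-irrefl refl)
        ... | tri> _ _ i<j = inj₂ (i<j , Pj<Pi)
      disjoint : ∀ {j} → j < i → LaterSmaller i j → ⊥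
      disjoint j<i (i<j , _) = <-asym j<i i<j

    module _ (P-avoids312 : ∀ {a b c} → a < b → b < c → c < n → P b < P c → P c < P a → ⊥) where

      ascent⇒isLeftMax : ∀ {m} → suc m < n → P m < P (suc m) → IsLeftMax (suc m)
      ascent⇒isLeftMax {m} 1+m<n ascent {j} j<1+m with m<1+n⇒m<n∨m≡n j<1+m | P j <? P (suc m)
      ... | inj₂ refl | _         = ascent
      ... | inj₁ _    | yes below = below
      ... | inj₁ j<m  | no ¬below =
        ⊥-elim (P-avoids312 j<m (n<1+n m) 1+m<n ascent (P-≮⇒> (<-trans j<1+m 1+m<n) 1+m<n (<⇒≢ j<1+m) ¬below))

      ¬isLeftMax⇒descent : ∀ {m} → suc m < n → ¬ IsLeftMax (suc m) → P (suc m) < P m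
      ¬isLeftMax⇒descent {m} 1+m<n ¬lmax =
        P-≮⇒> (<-trans (n<1+n m) 1+m<n) 1+m<n (<⇒≢ (n<1+n m)) (λ ascent → ¬lmax (ascent⇒isLeftMax 1+m<n ascent))

      laterSmaller-descent : ∀ {m} → suc m < n → P (suc m) < P m → laterSmaller m ≡ laterSmaller (suc m) + 1
      laterSmaller-descent {m} 1+m<n descent = begin
        laterSmaller m                                     ≡⟨ count-⊎ n (laterSmaller? m) (laterSmaller? (suc m)) (_≟ suc m) split⇔ disjoint ⟩
        laterSmaller (suc m) + count n (_≟ suc m)          ≡⟨ cong (λ k → laterSmaller (suc m) + k) (count-≡ n 1+m<n) ⟩
        laterSmaller (suc m) + 1                           ∎
        where
        open ≡-Reasoning
        split⇔ : ∀ {j} → j < n → LaterSmaller m j ⇔ (LaterSmaller (suc m) j ⊎ j ≡ suc m)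
        split⇔ {j} j<n = mk⇔ split [ (λ (1+m<j , Pj<P1+m) → <-trans (n<1+n m) 1+m<j , <-trans Pj<P1+m descent)
                                   , (λ { refl → n<1+n m , descent }) ]
          where
          split : LaterSmaller m j → LaterSmaller (suc m) j ⊎ j ≡ suc m
          split (m<j , Pj<Pm) with j ≟ suc m | P j <? P (suc m)
          ... | yes j≡1+m | _         = inj₂ j≡1+m
          ... | no j≢1+m  | yes below = inj₁ (≤∧≢⇒< m<j (j≢1+m ∘ sym) , below)
          ... | no j≢1+m  | no ¬below =
            ⊥-elim (P-avoids312 (n<1+n m) (≤∧≢⇒< m<j (j≢1+m ∘ sym)) j<n (P-≮⇒> j<n 1+m<n j≢1+m ¬below) Pj<Pm)
        disjoint : ∀ {j} → LaterSmaller (suc m) j → j ≡ suc m → ⊥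
        disjoint (1+m<j , _) refl = <-irrefl refl 1+m<j

      occurrencesAt+carry : ∀ m → occurrencesAt m + carry (suc m) ≡ laterSmaller m
      occurrencesAt+carry m with suc m <? n | isLeftMax? (suc m)
      ... | no 1+m≮n | _ = trans (+-identityʳ _) (trans (occurrencesAt-last 1+m≮n) (sym (laterSmaller-last 1+m≮n)))
      ... | yes _ | yes lmax = trans (+-identityʳ _) (occurrencesAt-ascent (lmax (n<1+n m)))
      ... | yes 1+m<n | no ¬lmax = begin
        occurrencesAt m + suc (laterSmaller (suc m)) ≡⟨ cong (_+ suc (laterSmaller (suc m))) (occurrencesAt-descent (<⇒≯ descent)) ⟩
        1 + laterSmaller (suc m)                     ≡⟨ +-comm 1 (laterSmaller (suc m)) ⟩
        laterSmaller (suc m) + 1                     ≡⟨ laterSmaller-descent 1+m<n descent ⟨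
        laterSmaller m                               ∎
        where
        open ≡-Reasoning
        descent : P (suc m) < P m
        descent = ¬isLeftMax⇒descent 1+m<n ¬lmax

      sum-occurrencesAt+count-¬isLeftMax :
        sumBelow n occurrencesAt + count n (¬? ∘ isLeftMax?) ≡ sumBelow n lmaxWeight
      sum-occurrencesAt+count-¬isLeftMax = +-cancelʳ-≡ (sumBelow n carry) _ _ (begin
        (O + N) + C                                          ≡⟨ +-right-comm O N C ⟩
        (O + C) + N                                          ≡⟨ cong (λ c → (O + c) + N) (sumBelow-rotate n carry (trans carry-0 (sym carry-n))) ⟨
        (O + sumBelow n (carry ∘ suc)) + N                   ≡⟨ cong (_+ N) (sumBelow-+ n occurrencesAt (carry ∘ suc)) ⟨
        (∑[ i < n ] (occurrencesAt i + carry (suc i))) + N   ≡⟨ cong (_+ N) (sumBelow-cong n λ {i} _ → occurrencesAt+carry i) ⟩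
        sumBelow n laterSmaller + N                          ≡⟨ sumBelow-+ n laterSmaller _ ⟨
        (∑[ i < n ] (laterSmaller i + indicator (does (¬? (isLeftMax? i))))) ≡⟨ sumBelow-cong n lmaxWeight+carry ⟨
        (∑[ i < n ] (lmaxWeight i + carry i))                ≡⟨ sumBelow-+ n lmaxWeight carry ⟩
        sumBelow n lmaxWeight + C                            ∎)
        where
        open ≡-Reasoning
        O N C : ℕ
        O = sumBelow n occurrencesAt
        N = count n (¬? ∘ isLeftMax?)
        C = sumBelow n carry

-- Permutations in one-line notation

module OneLine (n : ℕ) (π : Fin n → Fin n) where

  open Vincular231 n (valAt n π)

  valAt-fromℕ< : ∀ {k} (k<n : k < n) → valAt n π k ≡ toℕ (π (fromℕ< k<n))
  valAt-fromℕ< {k} k<n with k <? n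
  ... | yes k<n′ = cong (λ p → toℕ (π (fromℕ< p))) (<-irrelevant k<n′ k<n)
  ... | no k≮n   = contradiction k<n k≮n

  valAt-toℕ : ∀ i → valAt n π (toℕ i) ≡ toℕ (π i)
  valAt-toℕ i = trans (valAt-fromℕ< (toℕ<n i)) (cong (toℕ ∘ π) (fromℕ<-toℕ i (toℕ<n i)))

  valAt-bounded : ∀ {k} → k < n → valAt n π k < n
  valAt-bounded k<n = subst (_< n) (sym (valAt-fromℕ< k<n)) (toℕ<n _)

  valAt-injective : IsPerm n π → ∀ {j k} → j < n → k < n → valAt n π j ≡ valAt n π k → j ≡ k
  valAt-injective inj {j} {k} j<n k<n eq = begin
    j                    ≡⟨ toℕ-fromℕ< j<n ⟨
    toℕ (fromℕ< j<n)     ≡⟨ cong toℕ (inj (toℕ-injective (trans (sym (valAt-fromℕ< j<n)) (trans eq (valAt-fromℕ< k<n))))) ⟩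
    toℕ (fromℕ< k<n)     ≡⟨ toℕ-fromℕ< k<n ⟩
    k                    ∎
    where open ≡-Reasoning

  valAt-avoids312 : Avoids312 n π → ∀ {a b c} → a < b → b < c → c < n →
                    valAt n π b < valAt n π c → valAt n π c < valAt n π a → ⊥
  valAt-avoids312 av {a} {b} {c} a<b b<c c<n Pb<Pc Pc<Pa =
    av (fromℕ< a<n) (fromℕ< b<n) (fromℕ< c<n)
       (subst₂ _<_ (sym (toℕ-fromℕ< a<n)) (sym (toℕ-fromℕ< b<n)) a<b)
       (subst₂ _<_ (sym (toℕ-fromℕ< b<n)) (sym (toℕ-fromℕ< c<n)) b<c)
       (subst₂ _<_ (valAt-fromℕ< b<n) (valAt-fromℕ< c<n) Pb<Pc , subst₂ _<_ (valAt-fromℕ< c<n) (valAt-fromℕ< a<n) Pc<Pa)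
    where
    b<n : b < n
    b<n = <-trans b<c c<n
    a<n : a < n
    a<n = <-trans a<b b<n

  occ-23-1≡occurrence? : ∀ i j → occ-23-1 n π i j ≡ does (occurrence? (toℕ i) (toℕ j))
  occ-23-1≡occurrence? i j rewrite valAt-toℕ i | valAt-toℕ j =
    cong₂ _∧_ (isYes≗does (suc (toℕ i) <? toℕ j))
              (cong₂ _∧_ (isYes≗does (toℕ (π j) <? toℕ (π i))) (isYes≗does (toℕ (π i) <? valAt n π (suc (toℕ i)))))

  count-23-1≡sum-occurrencesAt : count-23-1 n π ≡ sumBelow n occurrencesAt
  count-23-1≡sum-occurrencesAt = begin
    count-23-1 n π
      ≡⟨ length-filter-T? (λ (i , j) → occ-23-1 n π i j) (cartesianProduct (allFin n) (allFin n)) ⟩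
    sum (map (λ (i , j) → indicator (occ-23-1 n π i j)) (cartesianProduct (allFin n) (allFin n)))
      ≡⟨ sum-map-cartesianProduct _ (allFin n) (allFin n) ⟩
    sum (map (λ i → sum (map (λ j → indicator (occ-23-1 n π i j)) (allFin n))) (allFin n))
      ≡⟨ sum-map-allFin n _ occurrencesAt (λ i → sum-map-allFin n _ _ (cong indicator ∘ occ-23-1≡occurrence? i)) ⟩
    sumBelow n occurrencesAt
      ∎
    where open ≡-Reasoning

  isLmax≡isLeftMax? : ∀ i → isLmax n π i ≡ does (isLeftMax? (toℕ i))
  isLmax≡isLeftMax? i = trans isLmax≡all (does-≡ (All.all? C? (allFin n)) (map′ to-all from-all (isLeftMax? (toℕ i))))
    where
    C? : ∀ j → Dec (toℕ j < toℕ i → toℕ (π j) < toℕ (π i))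
    C? j = (toℕ j <? toℕ i) →-dec (toℕ (π j) <? toℕ (π i))
    c : Fin n → Bool
    c j = not ⌊ toℕ j <? toℕ i ⌋ ∨ (toℕ (π j) <ᵇ toℕ (π i))
    c≡C? : ∀ j → c j ≡ does (C? j)
    c≡C? j = cong₂ (λ a b → not a ∨ b) (isYes≗does (toℕ j <? toℕ i)) (isYes≗does (toℕ (π j) <? toℕ (π i)))
    -- isLmax is computed by a local function of Defs that cannot be named, so it is
    -- abstracted here as the F of all-unique and identified by its defining equations.
    isLmax≡all : isLmax n π i ≡ does (All.all? C? (allFin n))
    isLmax≡all with all-unique C? c _ c≡C? | allFin n
    ... | allB≡all | js = allB≡all refl (λ _ _ → refl) js
    to-all : IsLeftMax (toℕ i) → All _ (allFin n)
    to-all lmax = tabulate⁺ λ j j<i → subst₂ _<_ (valAt-toℕ j) (valAt-toℕ i) (lmax j<i)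
    from-all : All _ (allFin n) → IsLeftMax (toℕ i)
    from-all all {k} k<i = subst₂ _<_ (sym (valAt-fromℕ< k<n)) (sym (valAt-toℕ i))
      (tabulate⁻ all (fromℕ< k<n) (subst (_< toℕ i) (sym (toℕ-fromℕ< k<n)) k<i))
      where
      k<n : k < n
      k<n = <-trans k<i (toℕ<n i)

  lmax≡count-isLeftMax : lmax n π ≡ count n isLeftMax?
  lmax≡count-isLeftMax =
    trans (length-filter-T? (isLmax n π) (allFin n)) (sum-map-allFin n _ _ (cong indicator ∘ isLmax≡isLeftMax?))

  sumLmax≡sum-lmaxWeight : IsPerm n π → sumLmax n π ≡ + sumBelow n lmaxWeight
  sumLmax≡sum-lmaxWeight inj =
    trans (foldr-+-map-filter (isLmax n π) _ (lmaxWeight ∘ toℕ) weight-lmax weight-¬lmax (allFin n))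
          (cong +_ (sum-map-allFin n _ lmaxWeight λ _ → refl))
    where
    weight-lmax : ∀ i → isLmax n π i ≡ true → + toℕ (π i) ℤ.- + toℕ i ≡ + lmaxWeight (toℕ i)
    weight-lmax i lmaxᵇ with isLeftMax? (toℕ i) | isLmax≡isLeftMax? i
    ... | no _     | lmaxᵇ≡false = contradiction (trans (sym lmaxᵇ) lmaxᵇ≡false) λ ()
    ... | yes lmax | _           = begin
      + toℕ (π i) ℤ.- + toℕ i                           ≡⟨ cong (λ v → + v ℤ.- + toℕ i) (trans (sym (valAt-toℕ i)) (sym ls+i≡πi)) ⟩
      + (laterSmaller (toℕ i) + toℕ i) ℤ.- + toℕ i       ≡⟨ +[m+n]-+n≡+m (laterSmaller (toℕ i)) (toℕ i) ⟩
      + laterSmaller (toℕ i)                             ∎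
      where
      open ≡-Reasoning
      ls+i≡πi : laterSmaller (toℕ i) + toℕ i ≡ valAt n π (toℕ i)
      ls+i≡πi = laterSmaller-isLeftMax (valAt-injective inj) valAt-bounded (toℕ<n i) lmax
    weight-¬lmax : ∀ i → isLmax n π i ≡ false → lmaxWeight (toℕ i) ≡ 0
    weight-¬lmax i ¬lmaxᵇ with isLeftMax? (toℕ i) | isLmax≡isLeftMax? i
    ... | no _  | _          = refl
    ... | yes _ | lmaxᵇ≡true = contradiction (trans (sym ¬lmaxᵇ) lmaxᵇ≡true) λ ()

lemma3p23 : (n : ℕ) → n ≥ 1 → (π : Fin n → Fin n) → IsPerm n π → Avoids312 n π →
    + count-23-1 n π ≡ (sumLmax n π ℤ.- + n) ℤ.+ + lmax n π
lemma3p23 n _ π inj av = begin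
  + count-23-1 n π                            ≡⟨ cong +_ count-23-1≡sum-occurrencesAt ⟩
  + O                                         ≡⟨ +m≡+[m+n]-+[n+o]++o O N L ⟩
  (+ (O + N) ℤ.- + (N + L)) ℤ.+ + L           ≡⟨ cong₂ (λ s m → (+ s ℤ.- + m) ℤ.+ + L) occurrences+nonLmax (count-complement n isLeftMax?) ⟩
  (+ sumBelow n lmaxWeight ℤ.- + n) ℤ.+ + L   ≡⟨ cong₂ (λ s l → (s ℤ.- + n) ℤ.+ + l) (sumLmax≡sum-lmaxWeight inj) lmax≡count-isLeftMax ⟨
  (sumLmax n π ℤ.- + n) ℤ.+ + lmax n π        ∎
  where
  open ≡-Reasoning
  open Vincular231 n (valAt n π)
  open OneLine n π
  O N L : ℕ
  O = sumBelow n occurrencesAt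
  N = count n (¬? ∘ isLeftMax?)
  L = count n isLeftMax?
  occurrences+nonLmax : O + N ≡ sumBelow n lmaxWeight
  occurrences+nonLmax = sum-occurrencesAt+count-¬isLeftMax (valAt-injective inj) (valAt-avoids312 av)
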